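{- Let $G$ be a finite, simple, connected, undirected graph that is a sputnik. Then every maximal independent set of $G$ is robust.
   Context: A connected spanning subgraph of $G=(V,E_G)$ is a connected graph $H=(V,E_H)$ with $E_H\subseteq E_G$. A maximal independent set (MIS) is a set of pairwise non-adjacent vertices maximal for inclusion. An MIS $S$ of $G$ is robust if $S$ is a maximal independent set in every connected spanning subgraph of $G$ (including $G$ itself). A vertex is pendant if it has degree $1$. A graph is a sputnik if every vertex that belongs to a cycle has at least one pendant neighbor. -}

module Defs where

open import Data.Nat using (ℕ; _≤_)
open import Data.Fin using (Fin)
open import Data.Fin.Subset using (Subset; _∈_; _⊆_)
open import Data.List using (List; _∷_; []; _++_; length)
open import Data.List.Relation.Unary.Unique.Propositional using (Unique)
open import Data.List.Relation.Unary.Linked using (Linked)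
import Data.List.Membership.Propositional as LMem
open import Data.Product using (Σ; ∃; _×_; _,_)
open import Relation.Nullary using (¬_)
open import Data.Empty using (⊥)
open import Relation.Binary using (Decidable)
open import Relation.Binary.PropositionalEquality using (_≡_)
open import Relation.Binary.Construct.Closure.ReflexiveTransitive using (Star)

record Graph (n : ℕ) : Set₁ where
  field
    Adj     : Fin n → Fin n → Set
    adj?    : Decidable Adj
    sym     : ∀ {u v} → Adj u v → Adj v u
    irrefl  : ∀ {u} → ¬ Adj u u
open Graph public

Connected : ∀ {n} → Graph n → Set
Connected G = ∀ u v → Star (Adj G) u v

SpanningSubgraph : ∀ {n} → Graph n → Graph n → Set
SpanningSubgraph H G = ∀ {u v} → Adj H u v → Adj G u v

-- A cycle: a list x ∷ xs of at least 3 pairwise distinct vertices,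
-- consecutive ones adjacent, and the last adjacent to the first.
IsCycle : ∀ {n} → Graph n → List (Fin n) → Set
IsCycle G [] = ⊥
IsCycle G (x ∷ xs) =
  (2 ≤ length xs) × Unique (x ∷ xs) × Linked (Adj G) (x ∷ xs ++ x ∷ [])

OnCycle : ∀ {n} → Graph n → Fin n → Set
OnCycle {n} G v = Σ (List (Fin n)) λ c → IsCycle G c × v LMem.∈ c

Pendant : ∀ {n} → Graph n → Fin n → Set
Pendant G v = Σ _ λ u → Adj G v u × (∀ w → Adj G v w → w ≡ u)

Sputnik : ∀ {n} → Graph n → Set
Sputnik G = ∀ v → OnCycle G v → Σ _ λ u → Adj G v u × Pendant G u

Independent : ∀ {n} → Graph n → Subset n → Set
Independent G S = ∀ u v → u ∈ S → v ∈ S → ¬ Adj G u v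

MIS : ∀ {n} → Graph n → Subset n → Set
MIS G S = Independent G S × (∀ T → Independent G T → S ⊆ T → T ⊆ S)

Robust : ∀ {n} → Graph n → Subset n → Set₁
Robust {n} G S = (H : Graph n) → SpanningSubgraph H G → Connected H → MIS H S

-- Let S be a maximal independent set of G and H a connected spanning subgraph.
-- S stays independent in H, so it suffices that every x ∉ S keeps an H-neighbour
-- in S. Take a G-neighbour u ∈ S of x. If the edge xu is missing from H, a simple
-- u–x path in H closes with xu to a cycle of G through x, so x has a pendant
-- neighbour q. The edge qx survives in H (it is the only way to reach q), and
-- q ∈ S because its only neighbour x is not in S.
module Submission where

open import Defs
open import Level using (_⊔_)
open import Data.Nat using (ℕ; _≤_; s≤s; z≤n)
import Data.Fin.Properties as Fin
open import Data.Fin.Subset using (Subset; _∈_; _∉_; _⊆_; _∪_; ⁅_⁆)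
open import Data.Fin.Subset.Properties using (_∈?_; x∈⁅x⁆; x∈⁅y⁆⇒x≡y; x∈p∪q⁻; p⊆p∪q; q⊆p∪q)
open import Data.List using (List; _∷_; []; _++_; length)
open import Data.List.Relation.Unary.Any using (here; there)
open import Data.List.Relation.Unary.All using ([])
open import Data.List.Relation.Unary.All.Properties using (¬Any⇒All¬)
open import Data.List.Relation.Unary.AllPairs using ([]; _∷_)
open import Data.List.Relation.Unary.Unique.Propositional using (Unique)
open import Data.List.Relation.Unary.Linked using (Linked; [-]; _∷_)
import Data.List.Membership.Propositional as List
import Data.List.Membership.DecPropositional as DecMembership
open import Data.Product using (∃; _×_; _,_; proj₁)
open import Data.Sum using (inj₁; inj₂)
open import Data.Empty using (⊥-elim)
open import Relation.Nullary using (¬_; yes; no)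
open import Relation.Nullary.Decidable using (_×-dec_)
open import Relation.Binary using (Rel; _⇒_; DecidableEquality)
open import Relation.Binary.PropositionalEquality using (refl; trans) renaming (sym to ≡-sym)
open import Relation.Binary.Construct.Closure.ReflexiveTransitive using (Star; ε; _◅_)

module _ {a ℓ} {A : Set a} (R : Rel A ℓ) where

  data Path : A → A → List A → Set (a ⊔ ℓ) where
    end  : ∀ {b} → Path b b (b ∷ [])
    step : ∀ {x y b xs} → R x y → Path y b xs → Path x b (x ∷ xs)

module _ {a ℓ} {A : Set a} {R : Rel A ℓ} where

  Path-map : ∀ {ℓ′} {Q : Rel A ℓ′} → R ⇒ Q → ∀ {x b xs} → Path R x b xs → Path Q x b xs
  Path-map f end        = end
  Path-map f (step r p) = step (f r) (Path-map f p)

  Path-last∈ : ∀ {x b xs} → Path R x b xs → b List.∈ xs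
  Path-last∈ end        = here refl
  Path-last∈ (step _ p) = there (Path-last∈ p)

  Path-nonempty : ∀ {x b xs} → Path R x b xs → 1 ≤ length xs
  Path-nonempty end        = s≤s z≤n
  Path-nonempty (step _ _) = s≤s z≤n

  Path-close : ∀ {x b z xs} → Path R x b xs → R b z → Linked R (xs ++ z ∷ [])
  Path-close end                 r = r ∷ [-]
  Path-close (step r end)        s = r ∷ s ∷ [-]
  Path-close (step r (step q p)) s = r ∷ Path-close (step q p) s

  Path-suffix : ∀ {x b xs y} → Path R x b xs → Unique xs → y List.∈ xs →
                ∃ λ ys → Path R y b ys × Unique ys
  Path-suffix end        u       (here refl) = _ , end , u
  Path-suffix (step r p) u       (here refl) = _ , step r p , u
  Path-suffix (step _ p) (_ ∷ u) (there y∈) = Path-suffix p u y∈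

  -- Each loop of a walk is cut off as soon as the repeated vertex is met.
  walk⇒simplePath : DecidableEquality A → ∀ {x b} → Star R x b →
                    ∃ λ xs → Path R x b xs × Unique xs
  walk⇒simplePath _≟_ ε = _ , end , [] ∷ []
  walk⇒simplePath _≟_ {x} (r ◅ w) with walk⇒simplePath _≟_ w
  ... | xs , p , u with DecMembership._∈?_ _≟_ x xs
  ...   | yes x∈ = Path-suffix p u x∈
  ...   | no x∉  = x ∷ xs , step r p , ¬Any⇒All¬ xs x∉ ∷ u

Dominating : ∀ {n} → Graph n → Subset n → Set
Dominating G S = ∀ x → x ∉ S → ∃ λ s → s ∈ S × Adj G x s

module _ {n : ℕ} (G : Graph n) {S : Subset n} where

  independent-insert : Independent G S → ∀ x → ¬ (∃ λ s → s ∈ S × Adj G x s) →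
                       Independent G (⁅ x ⁆ ∪ S)
  independent-insert indS x x↮S u v u∈ v∈ uv with x∈p∪q⁻ ⁅ x ⁆ S u∈ | x∈p∪q⁻ ⁅ x ⁆ S v∈
  ... | inj₂ u∈S | inj₂ v∈S = indS u v u∈S v∈S uv
  ... | inj₁ u∈x | inj₁ v∈x with x∈⁅y⁆⇒x≡y x u∈x | x∈⁅y⁆⇒x≡y x v∈x
  ...   | refl | refl = irrefl G uv
  independent-insert indS x x↮S u v u∈ v∈ uv | inj₁ u∈x | inj₂ v∈S with x∈⁅y⁆⇒x≡y x u∈x
  ...   | refl = x↮S (v , v∈S , uv)
  independent-insert indS x x↮S u v u∈ v∈ uv | inj₂ u∈S | inj₁ v∈x with x∈⁅y⁆⇒x≡y x v∈x
  ...   | refl = x↮S (u , u∈S , sym G uv)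

  MIS⇒dominating : MIS G S → Dominating G S
  MIS⇒dominating (indS , maximal) x x∉S
    with Fin.any? (λ s → (s ∈? S) ×-dec adj? G x s)
  ... | yes x~S = x~S
  ... | no  x↮S = ⊥-elim (x∉S (maximal (⁅ x ⁆ ∪ S) (independent-insert indS x x↮S)
                                         (q⊆p∪q ⁅ x ⁆ S) (p⊆p∪q S (x∈⁅x⁆ x))))

  dominating⇒MIS : Independent G S → Dominating G S → MIS G S
  dominating⇒MIS indS dom = indS , maximal
    where
    maximal : ∀ T → Independent G T → S ⊆ T → T ⊆ S
    maximal T indT S⊆T {x} x∈T with x ∈? S
    ... | yes x∈S = x∈S
    ... | no  x∉S with dom x x∉S
    ...   | s , s∈S , xs = ⊥-elim (indT x s x∈T (S⊆T s∈S) xs)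

  dominating-pendant∈ : Dominating G S → ∀ {x q} → x ∉ S → Adj G x q → Pendant G q → q ∈ S
  dominating-pendant∈ dom {x} {q} x∉S xq (_ , _ , unique) with q ∈? S
  ... | yes q∈S = q∈S
  ... | no  q∉S with dom q q∉S
  ...   | s , s∈S , qs with trans (unique s qs) (≡-sym (unique x (sym G xq)))
  ...     | refl = ⊥-elim (x∉S s∈S)

module _ {n : ℕ} (G H : Graph n) (H⊆G : SpanningSubgraph H G) where

  independent-spanning : ∀ {S} → Independent G S → Independent H S
  independent-spanning indS u v u∈S v∈S uv = indS u v u∈S v∈S (H⊆G uv)

  simplePath⇒OnCycle : ∀ {u x xs} → Path (Adj H) u x xs → Unique xs →
                       ¬ Adj H u x → Adj G x u → OnCycle G x
  simplePath⇒OnCycle end             _ _     xu = ⊥-elim (irrefl G xu)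
  simplePath⇒OnCycle (step ux end)   _ ux∉H  _  = ⊥-elim (ux∉H ux)
  simplePath⇒OnCycle p@(step _ (step _ q)) u _ xu =
    _ , (s≤s (Path-nonempty q) , u , Path-close (Path-map H⊆G p) xu) , Path-last∈ p

  missingEdge⇒OnCycle : Connected H → ∀ {x u} → Adj G x u → ¬ Adj H x u → OnCycle G x
  missingEdge⇒OnCycle conH xu xu∉H with walk⇒simplePath Fin._≟_ (conH _ _)
  ... | _ , p , unique = simplePath⇒OnCycle p unique (λ ux → xu∉H (sym H ux)) xu

  -- Any walk leaving a pendant vertex q starts along its unique edge.
  pendantEdge-spanning : ∀ {x q} → Adj G x q → Pendant G q → Star (Adj H) q x → Adj H q x
  pendantEdge-spanning xq _ ε = ⊥-elim (irrefl G xq)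
  pendantEdge-spanning {x} xq (_ , _ , unique) (qy ◅ _)
    with unique _ (H⊆G qy) | unique x (sym G xq)
  ... | refl | refl = qy

sputnik-dominating-spanning : ∀ {n} {G H : Graph n} {S} → Sputnik G → MIS G S →
  SpanningSubgraph H G → Connected H → Dominating H S
sputnik-dominating-spanning {G = G} {H} sputnik misS H⊆G conH x x∉S
  with MIS⇒dominating G misS x x∉S
... | u , u∈S , xu with adj? H x u
...   | yes xu∈H = u , u∈S , xu∈H
...   | no  xu∉H with sputnik x (missingEdge⇒OnCycle G H H⊆G conH xu xu∉H)
...     | q , xq , pendant =
  q , dominating-pendant∈ G (MIS⇒dominating G misS) x∉S xq pendant
    , sym H (pendantEdge-spanning G H H⊆G xq pendant (conH q x))

lemma2 : ∀ {n : ℕ} (G : Graph n) → Connected G → Sputnik G →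
    (S : Subset n) → MIS G S → Robust G S
lemma2 G _ sputnik S misS H H⊆G conH =
  dominating⇒MIS H (independent-spanning G H H⊆G (proj₁ misS))
                   (sputnik-dominating-spanning {H = H} sputnik misS H⊆G conH)
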